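{- Consider the Fuel-Constrained Multiple Vehicle Routing Problem (FCMVRP) described in the context. Let $x=(x_{ij})_{(i,j)\in E}\in\{0,1\}^E$ be the edge-incidence vector of a feasible solution (so $x_{ij}=1$ iff edge $(i,j)$ is traversed by some vehicle), and for every edge $(i,j)$ with $x_{ij}=1$ let $z_{ij}$ be the total fuel consumed by the traversing vehicle from the moment it last left a depot until it arrives at $j$ via the edge $(i,j)$; set $z_{ij}=0$ when $x_{ij}=0$. Define $t_i=\min_{d\in D} f_{id}$ and $s_i=\min_{d\in D} f_{di}$. Then, in the arc-based formulation, the bounds $0\le z_{ij}\le F x_{ij}$ for all $(i,j)\in E$ can be strengthened to the following inequalities, all of which are satisfied by $(x,z)$: $$z_{ij}\le (F-t_j)\,x_{ij}\quad \text{for all } j\in T \text{ and } (i,j)\in E,$$ $$z_{id}\le F\,x_{id}\quad \text{for all } i\in T,\ d\in D,$$ $$z_{ij}\ge (s_i+f_{ij})\,x_{ij}\quad \text{for all } i\in T \text{ and } (i,j)\in E.$$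
   Context: FCMVRP: Let $T=\{t_1,\dots,t_n\}$ be a set of targets and $D=\{d_1,\dots,d_k\}$ a set of depots (which are also refueling stations); each depot $d_k$ hosts one vehicle $v_k$, and all vehicles are homogeneous with fuel capacity $F$. The problem is defined on the complete directed graph $G=(V,E)$ with $V=T\cup D$ and no self-loops. Each edge $(i,j)$ has a nonnegative cost $c_{ij}$ and a fuel consumption $f_{ij}$ with $c_{ij}=K f_{ij}$ for a constant $K>0$; costs (hence fuel consumptions) are symmetric and satisfy the triangle inequality $c_{ij}+c_{jk}\ge c_{ik}$. Whenever a vehicle visits a depot it refuels to full capacity. A feasible solution consists of a route for each vehicle $v_k$ starting and ending at its own depot $d_k$ (it may pass through other depots to refuel), such that every target is visited exactly once by some vehicle and, for every vehicle, the fuel needed to traverse any segment of its route between two consecutive depot visits is at most $F$. The objective is to minimize the total cost of the edges used. In the arc-based formulation $\mathcal F_1$, the variables are $x_{ij}\in\{0,1\}$ and continuous fuel-flow variables $z_{ij}$ with constraints: $\sum_{i} x_{di}=\sum_i x_{id}$ for $d\in D$; $\sum_i x_{ij}=1=\sum_i x_{ji}$ for $j\in T$; $\sum_j z_{ij}-\sum_j z_{ji}=\sum_j f_{ij}x_{ij}$ for $i\in T$; $0\le z_{ij}\le F x_{ij}$ for $(i,j)\in E$; $z_{di}=f_{di}x_{di}$ for $i\in T, d\in D$.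
   Formalization: The fuel consumptions $f_{ij}$ and the fuel capacity $F$ are rational. -}

module Defs where

open import Data.Nat using (ℕ; zero; suc)
open import Data.Fin using (Fin; zero; suc)
open import Data.Fin.Properties using () renaming (_≟_ to _≟ᶠ_)
open import Data.Sum using (_⊎_; inj₁; inj₂)
open import Data.Sum.Properties using (≡-dec)
open import Data.Product using (Σ; _×_; _,_; ∃)
open import Data.List using (List; []; _∷_; _∷ʳ_; filter; length; map; concatMap; allFin)
open import Data.List.Relation.Unary.All using (All)
open import Data.Maybe using (Maybe; just; nothing)
open import Data.Rational using (ℚ; 0ℚ; 1ℚ; _+_; _⊓_; _≤_)
open import Relation.Binary.PropositionalEquality using (_≡_; _≢_)
open import Relation.Nullary using (Dec; yes; no)

-- Vertices: targets T = Fin n (tagged inj₁), depots D = Fin (suc k)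
-- (tagged inj₂).  D is nonempty (needed for the minima t_i, s_i).

Vertex : ℕ → ℕ → Set
Vertex n k = Fin n ⊎ Fin (suc k)

target : ∀ {n k} → Fin n → Vertex n k
target = inj₁

depot : ∀ {n k} → Fin (suc k) → Vertex n k
depot = inj₂

_≟ᵛ_ : ∀ {n k} (a b : Vertex n k) → Dec (a ≡ b)
_≟ᵛ_ = ≡-dec _≟ᶠ_ _≟ᶠ_

minOver : ∀ {k} → (Fin (suc k) → ℚ) → ℚ
minOver {zero}  g = g zero
minOver {suc k} g = g zero ⊓ minOver (λ d → g (suc d))

-- Instance data: fuel consumption f on the complete directed graph
-- without self-loops (values f a a are never used), nonnegative,
-- symmetric, satisfying the triangle inequality.

module _ {n k : ℕ} (f : Vertex n k → Vertex n k → ℚ) where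

  edgesFrom : Vertex n k → List (Vertex n k) → List (Vertex n k × Vertex n k)
  edgesFrom a []         = []
  edgesFrom a (b ∷ rest) = (a , b) ∷ edgesFrom b rest

  -- Fuel consumed on each segment between two consecutive depot visits
  -- of the walk  a ∷ rest  (acc = fuel consumed since the last depot).
  segmentFuels : ℚ → Vertex n k → List (Vertex n k) → List ℚ
  segmentFuels acc a []               = []
  segmentFuels acc a (inj₁ t ∷ rest)  = segmentFuels (acc + f a (inj₁ t)) (inj₁ t) rest
  segmentFuels acc a (inj₂ d ∷ rest)  = (acc + f a (inj₂ d)) ∷ segmentFuels 0ℚ (inj₂ d) rest

  -- Traversals (i , j , z) of the walk a ∷ rest, where z is the total
  -- fuel consumed since the vehicle last left a depot until it arrives
  -- at j via the edge (i , j).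
  resetAt : Vertex n k → ℚ → ℚ
  resetAt (inj₁ _) q = q
  resetAt (inj₂ _) q = 0ℚ

  traversals : ℚ → Vertex n k → List (Vertex n k) → List (Vertex n k × Vertex n k × ℚ)
  traversals acc a []         = []
  traversals acc a (b ∷ rest) =
    (a , b , acc + f a b) ∷ traversals (resetAt b (acc + f a b)) b rest

  count : Vertex n k → List (Vertex n k) → ℕ
  count v xs = length (filter (λ w → w ≟ᵛ v) xs)

  sumℕ : List ℕ → ℕ
  sumℕ []       = 0
  sumℕ (m ∷ ms) = m Data.Nat.+ sumℕ ms

  -- A feasible solution.  The route of vehicle v_d is the walk
  --   depot d ∷ route d,
  -- which starts at d and ends at d (route d is empty — vehicle unused —
  -- or its last vertex is depot d).
  record Feasible (F : ℚ) : Set where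
    field
      route       : Fin (suc k) → List (Vertex n k)
      closed      : ∀ d → route d ≡ [] ⊎ ∃ λ r → route d ≡ r ∷ʳ depot d
      noSelfLoops : ∀ d → All (λ e → Data.Product.proj₁ e ≢ Data.Product.proj₂ e)
                              (edgesFrom (depot d) (route d))
      visitOnce   : ∀ (t : Fin n) →
                    sumℕ (map (λ d → count (target t) (route d)) (allFin (suc k))) ≡ 1
      fuelOK      : ∀ d → All (λ q → q ≤ F) (segmentFuels 0ℚ (depot d) (route d))

  module _ {F : ℚ} (sol : Feasible F) where
    open Feasible sol

    allTraversals : List (Vertex n k × Vertex n k × ℚ)
    allTraversals = concatMap (λ d → traversals 0ℚ (depot d) (route d)) (allFin (suc k))

    findZ : Vertex n k → Vertex n k → List (Vertex n k × Vertex n k × ℚ) → Maybe ℚ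
    findZ i j [] = nothing
    findZ i j ((a , b , q) ∷ rest) with a ≟ᵛ i | b ≟ᵛ j
    ... | yes _ | yes _ = just q
    ... | _     | _     = findZ i j rest

    xVal : Vertex n k → Vertex n k → ℚ
    xVal i j with findZ i j allTraversals
    ... | just _  = 1ℚ
    ... | nothing = 0ℚ

    zVal : Vertex n k → Vertex n k → ℚ
    zVal i j with findZ i j allTraversals
    ... | just q  = q
    ... | nothing = 0ℚ

-- Follow each route while carrying the fuel consumed since the last depot.
-- Arriving at a depot, that fuel is a segment fuel, hence at most F.  Arriving
-- at a target j, the rest of the segment still has to reach some depot e, and
-- by the triangle inequality that costs at least f j e ≥ t j; so the fuel so
-- far is at most F - t j.  Dually, by the triangle inequality the fuel carried
-- at a target i is at least the direct distance from the depot the segment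
-- started at, hence at least s i.
module Submission where

open import Defs
open import Data.Nat using (ℕ; suc)
open import Data.Fin using (Fin)
open import Data.Product using (_×_; _,_; ∃; proj₁; proj₂)
open import Data.Sum using (_⊎_; inj₁; inj₂)
open import Data.Unit using (⊤; tt)
open import Data.Maybe using (just; nothing)
open import Data.List using (List; []; _∷_; _∷ʳ_; allFin; concatMap)
open import Data.List.Relation.Unary.All using (All; []; _∷_; universal)
open import Data.List.Relation.Unary.All.Properties using (concat⁺; map⁺)
open import Data.Rational using (ℚ; 0ℚ; _+_; _-_; _*_; _≤_; -_)
open import Data.Rational.Properties
  using (≤-refl; ≤-trans; ≤-reflexive; +-assoc; +-inverseʳ; +-identityʳ; +-identityˡ;
         *-identityʳ; *-zeroʳ; +-monoˡ-≤; +-monoʳ-≤; p⊓q≤p; p⊓q≤q)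
open import Relation.Binary.PropositionalEquality
  using (_≡_; _≢_; refl; sym; subst; cong; module ≡-Reasoning)
open import Relation.Nullary using (yes; no)
open import Function using (id)

minOver≤ : ∀ {k} (g : Fin (suc k) → ℚ) e → minOver g ≤ g e
minOver≤ {ℕ.zero}  g Fin.zero    = ≤-refl
minOver≤ {suc k}   g Fin.zero    = p⊓q≤p (g Fin.zero) _
minOver≤ {suc k}   g (Fin.suc e) = ≤-trans (p⊓q≤q (g Fin.zero) _) (minOver≤ (λ d → g (Fin.suc d)) e)

p+q≤r⇒p≤r-q : ∀ p q r → p + q ≤ r → p ≤ r - q
p+q≤r⇒p≤r-q p q r p+q≤r = subst (_≤ r - q) p+q-q≡p (+-monoˡ-≤ (- q) p+q≤r)
  where
  open ≡-Reasoning
  p+q-q≡p : p + q - q ≡ p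
  p+q-q≡p = begin
    p + q - q     ≡⟨ +-assoc p q (- q) ⟩
    p + (q - q)   ≡⟨ cong (p +_) (+-inverseʳ q) ⟩
    p + 0ℚ        ≡⟨ +-identityʳ p ⟩
    p             ∎

module _ {n k : ℕ} (f : Vertex n k → Vertex n k → ℚ) where

  private
    V : Set
    V = Vertex n k

    Traversal : Set
    Traversal = V × V × ℚ

  NoSelfLoops : V → List V → Set
  NoSelfLoops a rest = All (λ e → proj₁ e ≢ proj₂ e) (edgesFrom f a rest)

  closedRoute-elim : ∀ (P : List V → Set) rest d →
                     rest ≡ [] ⊎ ∃ (λ r → rest ≡ r ∷ʳ depot d) →
                     P [] → (∀ r → P (r ∷ʳ depot d)) → P rest
  closedRoute-elim P rest d (inj₁ refl)       p[] _     = p[]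
  closedRoute-elim P rest d (inj₂ (r , refl)) _   p∷ʳ = p∷ʳ r

  module _ {F : ℚ} (sol : Feasible f F) where

    All-allTraversals : ∀ {P : Traversal → Set} →
                        (∀ d → All P (traversals f 0ℚ (depot d) (Feasible.route sol d))) →
                        All P (allTraversals f sol)
    All-allTraversals all-d = concat⁺ (map⁺ (universal all-d (allFin (suc k))))

    findZ-All : ∀ {P : Traversal → Set} i j L {q} → All P L →
                findZ f sol i j L ≡ just q → P (i , j , q)
    findZ-All i j ((a , b , r) ∷ L) (p ∷ ps) eq with a ≟ᵛ i | b ≟ᵛ j
    findZ-All i j ((a , b , r) ∷ L) (p ∷ ps) refl | yes refl | yes refl = p
    ... | yes _ | no _ = findZ-All i j L ps eq
    ... | no _  | _    = findZ-All i j L ps eq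

    zVal≤*xVal : ∀ {P : Traversal → Set} i j c → All P (allTraversals f sol) →
                 (∀ {q} → P (i , j , q) → q ≤ c) → zVal f sol i j ≤ c * xVal f sol i j
    zVal≤*xVal i j c all bound with findZ f sol i j (allTraversals f sol) in eq
    ... | just q  = subst (q ≤_) (sym (*-identityʳ c)) (bound (findZ-All i j _ all eq))
    ... | nothing = ≤-reflexive (sym (*-zeroʳ c))

    *xVal≤zVal : ∀ {P : Traversal → Set} i j c → All P (allTraversals f sol) →
                 (∀ {q} → P (i , j , q) → c ≤ q) → c * xVal f sol i j ≤ zVal f sol i j
    *xVal≤zVal i j c all bound with findZ f sol i j (allTraversals f sol) in eq
    ... | just q  = subst (_≤ q) (sym (*-identityʳ c)) (bound (findZ-All i j _ all eq))
    ... | nothing = ≤-reflexive (*-zeroʳ c)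

  module _ (tri : ∀ a b c → a ≢ b → b ≢ c → a ≢ c → f a c ≤ f a b + f b c) where

    t : Fin n → ℚ
    t j = minOver (λ d → f (target j) (depot d))

    s : Fin n → ℚ
    s i = minOver (λ d → f (depot d) (target i))

    depotWithinReach : ∀ {F} acc u r e →
                       NoSelfLoops (target u) (r ∷ʳ depot e) →
                       All (_≤ F) (segmentFuels f acc (target u) (r ∷ʳ depot e)) →
                       ∃ λ e′ → acc + f (target u) (depot e′) ≤ F
    depotWithinReach acc u []             e _ (fuel≤F ∷ _) = e , fuel≤F
    depotWithinReach acc u (inj₂ e′ ∷ r) e _ (fuel≤F ∷ _) = e′ , fuel≤F
    depotWithinReach {F} acc u (inj₁ v ∷ r) e (u≢v ∷ nsl) fuels
      with depotWithinReach (acc + f (target u) (target v)) v r e nsl fuels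
    ... | e′ , reach = e′ , ≤-trans
      (+-monoʳ-≤ acc (tri (target u) (target v) (depot e′) u≢v (λ ()) (λ ())))
      (subst (_≤ F) (+-assoc acc _ _) reach)

    ArrivalBound : ℚ → Traversal → Set
    ArrivalBound F (_ , inj₁ j , z) = z ≤ F - t j
    ArrivalBound F (_ , inj₂ _ , z) = z ≤ F

    arrivalBounds : ∀ {F} acc a r e →
                    NoSelfLoops a (r ∷ʳ depot e) →
                    All (_≤ F) (segmentFuels f acc a (r ∷ʳ depot e)) →
                    All (ArrivalBound F) (traversals f acc a (r ∷ʳ depot e))
    arrivalBounds acc a [] e _ (fuel≤F ∷ _) = fuel≤F ∷ []
    arrivalBounds acc a (inj₂ d ∷ r) e (_ ∷ nsl) (fuel≤F ∷ fuels) =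
      fuel≤F ∷ arrivalBounds 0ℚ (depot d) r e nsl fuels
    arrivalBounds {F} acc a (inj₁ v ∷ r) e (_ ∷ nsl) fuels =
      p+q≤r⇒p≤r-q _ _ F (≤-trans (+-monoʳ-≤ acc′ (minOver≤ _ e′)) reach)
      ∷ arrivalBounds acc′ (target v) r e nsl fuels
      where
      acc′ = acc + f a (target v)
      reached = depotWithinReach acc′ v r e nsl fuels
      e′ = proj₁ reached
      reach = proj₂ reached

    DepartureBound : Traversal → Set
    DepartureBound (inj₁ i , j , z) = s i + f (target i) j ≤ z
    DepartureBound (inj₂ _ , _ , _) = ⊤

    FuelSinceDepot : ℚ → V → Set
    FuelSinceDepot acc (inj₁ u) = ∃ λ e → f (depot e) (target u) ≤ acc
    FuelSinceDepot acc (inj₂ _) = acc ≡ 0ℚ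

    fuelSinceDepot-step : ∀ acc a v → a ≢ target v → FuelSinceDepot acc a →
                          FuelSinceDepot (acc + f a (target v)) (target v)
    fuelSinceDepot-step acc (inj₁ u) v u≢v (e , e→u≤acc) =
      e , ≤-trans (tri (depot e) (target u) (target v) (λ ()) u≢v (λ ())) (+-monoˡ-≤ _ e→u≤acc)
    fuelSinceDepot-step acc (inj₂ e) v _ refl = e , ≤-reflexive (sym (+-identityˡ _))

    departureBounds : ∀ acc a rest → FuelSinceDepot acc a → NoSelfLoops a rest →
                      All DepartureBound (traversals f acc a rest)
    departureBounds acc a [] _ _ = []
    departureBounds acc a (b ∷ rest) inv (a≢b ∷ nsl) =
      departure a inv ∷ departureBounds _ b rest (next b a≢b) nsl
      where
      departure : ∀ a → FuelSinceDepot acc a → DepartureBound (a , b , acc + f a b)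
      departure (inj₁ i) (e , e→i≤acc) = +-monoˡ-≤ _ (≤-trans (minOver≤ _ e) e→i≤acc)
      departure (inj₂ _) _             = tt
      next : ∀ b → a ≢ b → FuelSinceDepot (resetAt f b (acc + f a b)) b
      next (inj₁ v) a≢v = fuelSinceDepot-step acc a v a≢v inv
      next (inj₂ _) _   = refl

proposition1 : (n k : ℕ) (f : Vertex n k → Vertex n k → ℚ) (F : ℚ) →
    (∀ a b → a ≢ b → 0ℚ ≤ f a b) →
    (∀ a b → a ≢ b → f a b ≡ f b a) →
    (∀ a b c → a ≢ b → b ≢ c → a ≢ c → f a c ≤ f a b + f b c) →
    (sol : Feasible f F) →
    ((i : Vertex n k) (j : Fin n) → i ≢ target j →
      zVal f sol i (target j)
        ≤ (F - minOver (λ d → f (target j) (depot d))) * xVal f sol i (target j))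
    × ((i : Fin n) (d : Fin (suc k)) →
      zVal f sol (target i) (depot d) ≤ F * xVal f sol (target i) (depot d))
    × ((i : Fin n) (j : Vertex n k) → target i ≢ j →
      (minOver (λ d → f (depot d) (target i)) + f (target i) j) * xVal f sol (target i) j
        ≤ zVal f sol (target i) j)
proposition1 n k f F _ _ tri sol =
    (λ i j _ → zVal≤*xVal f sol i (target j) _ arrivals id)
  , (λ i d → zVal≤*xVal f sol (target i) (depot d) F arrivals id)
  , (λ i j _ → *xVal≤zVal f sol (target i) j _ departures id)
  where
  open Feasible sol

  arrivals : All (ArrivalBound f tri F) (allTraversals f sol)
  arrivals = All-allTraversals f sol λ d →
    closedRoute-elim f
      (λ rest → NoSelfLoops f (depot d) rest → All (_≤ F) (segmentFuels f 0ℚ (depot d) rest) →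
                All (ArrivalBound f tri F) (traversals f 0ℚ (depot d) rest))
      (route d) d (closed d) (λ _ _ → []) (λ r → arrivalBounds f tri 0ℚ (depot d) r d)
      (noSelfLoops d) (fuelOK d)

  departures : All (DepartureBound f tri) (allTraversals f sol)
  departures = All-allTraversals f sol λ d →
    departureBounds f tri 0ℚ (depot d) (route d) refl (noSelfLoops d)
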